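{- Let $n\ge4$, $m=n-2$, and run the procedure described in the context on the straight linear 2-tree $G_n$ with unit resistances. Then for $1\le p\le m-1$, after the $p$-th $\Delta$–Y transformation, \[ s_p=\frac{F_p^2}{F_{2p+2}},\qquad b_p=\frac{F_{p+1}}{L_{p+1}},\qquad t_p=\frac{F_pF_{p+1}}{L_pL_{p+1}}. \]
   Context: $G_n$ is the graph on $\{1,\dots,n\}$ with $\{i,j\}$ an edge iff $0<|i-j|\le2$, each edge a resistor of resistance $1$. A $\Delta$–Y transformation replaces a triangle on nodes $N_1,N_2,N_3$ with resistances $R_C$ on $\{N_1,N_2\}$, $R_B$ on $\{N_1,N_3\}$, $R_A$ on $\{N_2,N_3\}$ by a new node $*$ joined to $N_1,N_2,N_3$ with resistances $R_1=\frac{R_BR_C}{R_A+R_B+R_C}$, $R_2=\frac{R_AR_C}{R_A+R_B+R_C}$, $R_3=\frac{R_AR_B}{R_A+R_B+R_C}$ respectively. Procedure: for $k=1,2,\dots,m-1$ in turn, the current network contains a triangle on vertices $k,k+1,k+2$; let $R_A^k,R_B^k,R_C^k$ be the resistances of its edges $\{k,k+1\},\{k,k+2\},\{k+1,k+2\}$. Replace it by a Y with new center $*$, with resistance $t_k=\frac{R_A^kR_B^k}{R_A^k+R_B^k+R_C^k}$ on $\{*,k\}$, $s_k=\frac{R_A^kR_C^k}{R_A^k+R_B^k+R_C^k}$ on $\{*,k+1\}$, $b_k=\frac{R_B^kR_C^k}{R_A^k+R_B^k+R_C^k}$ on $\{*,k+2\}$. Vertex $k+1$ now has neighbours only $*$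 and $k+3$; replace the path $*,k+1,k+3$ by one edge $\{*,k+3\}$ of resistance $s_k+1$, delete vertex $k+1$, and rename $*$ as $k+1$. $F_p$ are the Fibonacci numbers ($F_0=0,F_1=1,F_{p+1}=F_p+F_{p-1}$) and $L_p=F_{p-1}+F_{p+1}$ the Lucas numbers. -}

module Defs where

open import Data.Nat as ℕ using (ℕ; zero; suc; _∸_)
open import Data.Integer as ℤ using ()
open import Data.Rational as ℚ using (ℚ; 0ℚ; 1ℚ; _+_; _*_; _÷_)
open import Data.List using (List; []; _∷_; _++_; map; filterᵇ)
open import Data.Bool using (Bool; true; false; _∧_; _∨_; not; if_then_else_)
open import Data.Product using (_×_; _,_; proj₁; proj₂)
open import Relation.Nullary using (yes; no)
open import Relation.Binary.PropositionalEquality using (_≡_)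

fib : ℕ → ℕ
fib zero = zero
fib (suc zero) = 1
fib (suc (suc n)) = fib (suc n) ℕ.+ fib n

-- L_p = F_{p-1} + F_{p+1}  (used only for p ≥ 1)
lucas : ℕ → ℕ
lucas p = fib (p ∸ 1) ℕ.+ fib (suc p)

-- total division on ℚ (value 0 if the divisor is 0; never used with a zero divisor below)
_/ₜ_ : ℚ → ℚ → ℚ
p /ₜ q with q ℚ.≟ 0ℚ
... | yes _ = 0ℚ
... | no q≢0 = _÷_ p q {{ℚ.≢-nonZero q≢0}}

-- A resistor network: a list of edges {u , v} with resistance r
Edge : Set
Edge = ℕ × ℕ × ℚ

Network : Set
Network = List Edge

-- the edges of G_n with unit resistances: {i,i+1} and {i,i+2} inside {1,...,n}
edgesFrom : ℕ → ℕ → Network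
edgesFrom i zero = []
edgesFrom i (suc k) =
  (if 1 ℕ.≤ᵇ k then (i , suc i , 1ℚ) ∷ [] else []) ++
  (if 2 ℕ.≤ᵇ k then (i , suc (suc i) , 1ℚ) ∷ [] else []) ++
  edgesFrom (suc i) k

G : ℕ → Network
G n = edgesFrom 1 n

joins : ℕ → ℕ → Edge → Bool
joins a b (u , v , _) = ((u ℕ.≡ᵇ a) ∧ (v ℕ.≡ᵇ b)) ∨ ((u ℕ.≡ᵇ b) ∧ (v ℕ.≡ᵇ a))

incident : ℕ → Edge → Bool
incident a (u , v , _) = (u ℕ.≡ᵇ a) ∨ (v ℕ.≡ᵇ a)

-- resistance of the edge {a,b} (0 if absent)
res : Network → ℕ → ℕ → ℚ
res [] a b = 0ℚ
res (e@(_ , _ , r) ∷ N) a b = if joins a b e then r else res N a b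

removeEdge : ℕ → ℕ → Network → Network
removeEdge a b = filterᵇ (λ e → not (joins a b e))

deleteVertex : ℕ → Network → Network
deleteVertex a = filterᵇ (λ e → not (incident a e))

-- the new centre * is labelled 0 (the original vertices are 1..n)
star : ℕ
star = 0

rename : ℕ → ℕ → Network → Network
rename a c = map (λ { (u , v , r) → ((if u ℕ.≡ᵇ a then c else u) , (if v ℕ.≡ᵇ a then c else v) , r) })

record StepResult : Set where
  field
    t s b : ℚ
    net : Network

step : ℕ → Network → StepResult
step k N = record { t = tk ; s = sk ; b = bk ; net = N₃ }
  where
  RA = res N k (suc k)
  RB = res N k (suc (suc k))
  RC = res N (suc k) (suc (suc k))
  Σ = RA + RB + RC
  tk = (RA * RB) /ₜ Σ
  sk = (RA * RC) /ₜ Σ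
  bk = (RB * RC) /ₜ Σ
  -- Δ–Y: remove the triangle, add the Y with centre *
  N₁ = (star , k , tk) ∷ (star , suc k , sk) ∷ (star , suc (suc k) , bk) ∷
       removeEdge k (suc k) (removeEdge k (suc (suc k)) (removeEdge (suc k) (suc (suc k)) N))
  -- series reduction of the path *, k+1, k+3 to one edge {*, k+3} of resistance s_k + 1
  N₂ = (star , suc (suc (suc k)) , sk + 1ℚ) ∷ deleteVertex (suc k) N₁
  N₃ = rename star (suc k) N₂

steps : ℕ → Network → Network
steps zero N = N
steps (suc j) N = StepResult.net (step (suc j) (steps j N))

stepOn : ℕ → ℕ → StepResult
stepOn n p = step p (steps (p ∸ 1) (G n))

sₚ bₚ tₚ : ℕ → ℕ → ℚ
sₚ n p = StepResult.s (stepOn n p)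
bₚ n p = StepResult.b (stepOn n p)
tₚ n p = StepResult.t (stepOn n p)

ι : ℕ → ℚ
ι k = (ℤ.+ k) ℚ./ 1

-- A Δ–Y step at k only touches edges with an endpoint in {k, k+1}, so it leaves the resistance
-- between any two vertices ≥ k+2 unchanged.  Hence the triangle met at step j+1 has sides
-- R_A = b_j, R_B = s_j + 1 (created by the previous step) and R_C = 1 (an untouched edge of G_n),
-- and (R_A, R_B) obeys the recurrence (A, B) ↦ (B/Σ, A/Σ + 1), Σ = A + B + 1, from (1, 1).
-- Its solution is (F_{j+1}/L_{j+1}, F_{j+2}²/(F_{j+1}L_{j+1})): with x = F_j, y = F_{j+1} the
-- induction step reduces to Σ = F_{j+2}L_{j+2}/(F_{j+1}L_{j+1}) and F_{j+1}² + F_{j+2}L_{j+2} = F_{j+3}²,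
-- both polynomial identities in x and y.  The stated formulas follow, using F_{2n} = F_n L_n.

module Submission where

open import Defs
open import Data.Nat using (ℕ; _≤_; _∸_; _+_; _*_)
open import Data.Rational using (ℚ)
open import Data.Product using (_×_)
open import Relation.Binary.PropositionalEquality using (_≡_)

open import Algebra.Bundles using (CommutativeRing)
open import Data.Bool using (true; false; T; not; if_then_else_; _∧_; _∨_)
open import Data.Bool.Properties using (T-∧; T-∨; T-≡)
open import Data.Empty using (⊥-elim)
open import Data.Integer as ℤ using (+_)
import Data.Integer.Properties as ℤ
open import Data.Integer.GCD using (gcd-zeroʳ)
open import Data.List using ([]; _∷_; filterᵇ)
open import Data.List.Properties using (filter-accept; filter-reject)
open import Data.List.Relation.Unary.All as All using (All; []; _∷_)
open import Data.List.Relation.Unary.All.Properties using (all-filter)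
open import Data.Nat as ℕ using (zero; suc; _≡ᵇ_; _<_; _≟_; s≤s; z≤n; z<s; NonZero; >-nonZero)
open import Data.Nat.Properties as ℕ
  using (≡ᵇ⇒≡; ≡⇒≡ᵇ; <⇒≢; >⇒≢; <⇒≤; n<1+n; m<n⇒m<1+n; ≤-refl; ≤-trans; <-≤-trans; n≤1+n;
         m≤m+n; m≤n+m; +-identityʳ; +-suc; +-comm; m*n≢0; m≤n⇒∃[o]m+o≡n)
open import Data.Nat.Tactic.RingSolver using (solve-∀)
open import Data.Product using (_,_; proj₁; proj₂)
import Data.Product as Product
open import Data.Rational as ℚ using (0ℚ; 1ℚ; 1/_; ↥_; ↧_; toℚᵘ)
open import Data.Rational.Properties
  using (↥-/; ↧-/; ↥ᵘ-toℚᵘ; ↧ᵘ-toℚᵘ; toℚᵘ-injective; toℚᵘ-homo-+; toℚᵘ-homo-*;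
         *-assoc; *-identityʳ; *-identityˡ; *-zeroˡ; *-inverseˡ; *-inverseʳ; *-distribʳ-+;
         +-*-commutativeRing)
import Data.Rational.Unnormalised as ℚᵘ
import Data.Rational.Unnormalised.Properties as ℚᵘ
open import Data.Sum using (_⊎_; inj₁; inj₂)
import Data.Sum as Sum
open import Function using (_∘_; Equivalence)
open import Relation.Nullary using (¬_; yes; no; T?)
open import Relation.Binary.PropositionalEquality
  using (_≢_; refl; sym; trans; cong; cong₂; ≢-sym; module ≡-Reasoning)

open import Algebra.Properties.CommutativeSemigroup
  (CommutativeRing.*-commutativeSemigroup +-*-commutativeRing) using (interchange; x∙yz≈y∙xz)

open Equivalence using (to; from)

↥-ι : ∀ k → ↥ ι k ≡ + k
↥-ι k = trans (sym (ℤ.*-identityʳ _)) (trans (cong (↥ ι k ℤ.*_) (sym (gcd-zeroʳ (+ k)))) (↥-/ (+ k) 1))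

↧-ι : ∀ k → ↧ ι k ≡ + 1
↧-ι k = trans (sym (ℤ.*-identityʳ _)) (trans (cong (↧ ι k ℤ.*_) (sym (gcd-zeroʳ (+ k)))) (↧-/ (+ k) 1))

toℚᵘ-ι : ∀ k → toℚᵘ (ι k) ℚᵘ.≃ ℚᵘ.mkℚᵘ (+ k) 0
toℚᵘ-ι k = ℚᵘ.*≡* (cong₂ ℤ._*_ (trans (↥ᵘ-toℚᵘ (ι k)) (↥-ι k)) (sym (trans (↧ᵘ-toℚᵘ (ι k)) (↧-ι k))))

ι-homo-+ : ∀ a b → ι (a + b) ≡ ι a ℚ.+ ι b
ι-homo-+ a b = toℚᵘ-injective (begin
  toℚᵘ (ι (a + b))                            ≈⟨ toℚᵘ-ι (a + b) ⟩
  ℚᵘ.mkℚᵘ (+ (a + b)) 0                       ≈⟨ ℚᵘ.*≡* (cong (ℤ._* + 1) (trans (ℤ.pos-+ a b)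
                                                    (sym (cong₂ ℤ._+_ (ℤ.*-identityʳ (+ a)) (ℤ.*-identityʳ (+ b)))))) ⟩
  ℚᵘ.mkℚᵘ (+ a) 0 ℚᵘ.+ ℚᵘ.mkℚᵘ (+ b) 0        ≈⟨ ℚᵘ.+-cong (toℚᵘ-ι a) (toℚᵘ-ι b) ⟨
  toℚᵘ (ι a) ℚᵘ.+ toℚᵘ (ι b)                  ≈⟨ toℚᵘ-homo-+ (ι a) (ι b) ⟨
  toℚᵘ (ι a ℚ.+ ι b)                          ∎)
  where open ℚᵘ.≃-Reasoning

ι-homo-* : ∀ a b → ι (a * b) ≡ ι a ℚ.* ι b
ι-homo-* a b = toℚᵘ-injective (begin
  toℚᵘ (ι (a * b))                            ≈⟨ toℚᵘ-ι (a * b) ⟩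
  ℚᵘ.mkℚᵘ (+ (a * b)) 0                       ≈⟨ ℚᵘ.*≡* (cong (ℤ._* + 1) (ℤ.pos-* a b)) ⟩
  ℚᵘ.mkℚᵘ (+ a) 0 ℚᵘ.* ℚᵘ.mkℚᵘ (+ b) 0        ≈⟨ ℚᵘ.*-cong (toℚᵘ-ι a) (toℚᵘ-ι b) ⟨
  toℚᵘ (ι a) ℚᵘ.* toℚᵘ (ι b)                  ≈⟨ toℚᵘ-homo-* (ι a) (ι b) ⟨
  toℚᵘ (ι a ℚ.* ι b)                          ∎)
  where open ℚᵘ.≃-Reasoning

ι-nonZero : ∀ k .{{_ : NonZero k}} → ι k ≢ 0ℚ
ι-nonZero (suc k) ιk≡0 with trans (sym (↥-ι (suc k))) (cong ↥_ ιk≡0)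
... | ()

p/ₜq*q≡p : ∀ p q → q ≢ 0ℚ → (p /ₜ q) ℚ.* q ≡ p
p/ₜq*q≡p p q q≢0 with q ℚ.≟ 0ℚ
... | yes q≡0 = ⊥-elim (q≢0 q≡0)
... | no  _   = begin
  (p ℚ.* 1/ q) ℚ.* q   ≡⟨ *-assoc p (1/ q) q ⟩
  p ℚ.* (1/ q ℚ.* q)   ≡⟨ cong (p ℚ.*_) (*-inverseˡ q) ⟩
  p ℚ.* 1ℚ             ≡⟨ *-identityʳ p ⟩
  p                    ∎
  where
  open ≡-Reasoning
  instance
    q-nonZero : ℚ.NonZero q
    q-nonZero = ℚ.≢-nonZero q≢0

p≡r*q⇒p/ₜq≡r : ∀ p q r → q ≢ 0ℚ → p ≡ r ℚ.* q → p /ₜ q ≡ r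
p≡r*q⇒p/ₜq≡r p q r q≢0 refl with q ℚ.≟ 0ℚ
... | yes q≡0 = ⊥-elim (q≢0 q≡0)
... | no  _   = begin
  (r ℚ.* q) ℚ.* 1/ q   ≡⟨ *-assoc r q (1/ q) ⟩
  r ℚ.* (q ℚ.* 1/ q)   ≡⟨ cong (r ℚ.*_) (*-inverseʳ q) ⟩
  r ℚ.* 1ℚ             ≡⟨ *-identityʳ r ⟩
  r                    ∎
  where
  open ≡-Reasoning
  instance
    q-nonZero : ℚ.NonZero q
    q-nonZero = ℚ.≢-nonZero q≢0

*-/ₜ-assoc : ∀ p q r → r ≢ 0ℚ → (p ℚ.* q) /ₜ r ≡ p ℚ.* (q /ₜ r)
*-/ₜ-assoc p q r r≢0 = p≡r*q⇒p/ₜq≡r (p ℚ.* q) r (p ℚ.* (q /ₜ r)) r≢0 (begin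
  p ℚ.* q                     ≡⟨ cong (p ℚ.*_) (p/ₜq*q≡p q r r≢0) ⟨
  p ℚ.* ((q /ₜ r) ℚ.* r)      ≡⟨ *-assoc p (q /ₜ r) r ⟨
  p ℚ.* (q /ₜ r) ℚ.* r        ∎)
  where open ≡-Reasoning

frac : ℕ → ℕ → ℚ
frac a b = ι a /ₜ ι b

module _ {b : ℕ} .{{_ : NonZero b}} where

  frac*den : ∀ a → frac a b ℚ.* ι b ≡ ι a
  frac*den a = p/ₜq*q≡p (ι a) (ι b) (ι-nonZero b)

  frac-unique : ∀ a q → q ℚ.* ι b ≡ ι a → frac a b ≡ q
  frac-unique a q eq = p≡r*q⇒p/ₜq≡r (ι a) (ι b) q (ι-nonZero b) (sym eq)

  frac-+ : ∀ a c → frac a b ℚ.+ frac c b ≡ frac (a + c) b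
  frac-+ a c = sym (frac-unique (a + c) _ (begin
    (frac a b ℚ.+ frac c b) ℚ.* ι b           ≡⟨ *-distribʳ-+ (ι b) (frac a b) (frac c b) ⟩
    frac a b ℚ.* ι b ℚ.+ frac c b ℚ.* ι b     ≡⟨ cong₂ ℚ._+_ (frac*den a) (frac*den c) ⟩
    ι a ℚ.+ ι c                               ≡⟨ ι-homo-+ a c ⟨
    ι (a + c)                                 ∎))
    where open ≡-Reasoning

  frac-self : frac b b ≡ 1ℚ
  frac-self = frac-unique b 1ℚ (*-identityˡ (ι b))

  frac-≢0 : ∀ a .{{_ : NonZero a}} → frac a b ≢ 0ℚ
  frac-≢0 a eq = ι-nonZero a (begin
    ι a                ≡⟨ frac*den a ⟨
    frac a b ℚ.* ι b   ≡⟨ cong (ℚ._* ι b) eq ⟩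
    0ℚ ℚ.* ι b         ≡⟨ *-zeroˡ (ι b) ⟩
    0ℚ                 ∎)
    where open ≡-Reasoning

frac-* : ∀ a b c d .{{_ : NonZero b}} .{{_ : NonZero d}} →
  frac a b ℚ.* frac c d ≡ frac (a * c) (b * d)
frac-* a b c d = sym (frac-unique {{m*n≢0 b d}} (a * c) _ (begin
  (frac a b ℚ.* frac c d) ℚ.* ι (b * d)          ≡⟨ cong (frac a b ℚ.* frac c d ℚ.*_) (ι-homo-* b d) ⟩
  (frac a b ℚ.* frac c d) ℚ.* (ι b ℚ.* ι d)      ≡⟨ interchange (frac a b) (frac c d) (ι b) (ι d) ⟩
  (frac a b ℚ.* ι b) ℚ.* (frac c d ℚ.* ι d)      ≡⟨ cong₂ ℚ._*_ (frac*den a) (frac*den c) ⟩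
  ι a ℚ.* ι c                                    ≡⟨ ι-homo-* a c ⟨
  ι (a * c)                                      ∎))
  where open ≡-Reasoning

frac-cancelˡ : ∀ c a b .{{_ : NonZero c}} .{{_ : NonZero b}} → frac (c * a) (c * b) ≡ frac a b
frac-cancelˡ c a b = frac-unique {{m*n≢0 c b}} (c * a) _ (begin
  frac a b ℚ.* ι (c * b)         ≡⟨ cong (frac a b ℚ.*_) (ι-homo-* c b) ⟩
  frac a b ℚ.* (ι c ℚ.* ι b)     ≡⟨ x∙yz≈y∙xz (frac a b) (ι c) (ι b) ⟩
  ι c ℚ.* (frac a b ℚ.* ι b)     ≡⟨ cong (ι c ℚ.*_) (frac*den a) ⟩
  ι c ℚ.* ι a                    ≡⟨ ι-homo-* c a ⟨
  ι (c * a)                      ∎)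
  where open ≡-Reasoning

frac-/ₜ : ∀ a c d .{{_ : NonZero c}} .{{_ : NonZero d}} → frac a d /ₜ frac c d ≡ frac a c
frac-/ₜ a c d = p≡r*q⇒p/ₜq≡r (frac a d) (frac c d) (frac a c) (frac-≢0 c) (sym (begin
  frac a c ℚ.* frac c d      ≡⟨ frac-* a c c d ⟩
  frac (a * c) (c * d)       ≡⟨ cong (λ n → frac n (c * d)) (ℕ.*-comm a c) ⟩
  frac (c * a) (c * d)       ≡⟨ frac-cancelˡ c a d ⟩
  frac a d                   ∎))
  where open ≡-Reasoning

fib-+ : ∀ m n → fib (suc (m + n)) ≡ fib (suc m) * fib (suc n) + fib m * fib n
fib-+ zero    n = sym (trans (+-identityʳ (1 * fib (suc n))) (ℕ.*-identityˡ (fib (suc n))))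
fib-+ (suc m) n = begin
  fib (suc (suc m + n))                                   ≡⟨ cong (λ k → fib (suc k)) (+-suc m n) ⟨
  fib (suc (m + suc n))                                   ≡⟨ fib-+ m (suc n) ⟩
  fib (suc m) * fib (suc (suc n)) + fib m * fib (suc n)   ≡⟨ shuffle (fib (suc m)) (fib m) (fib (suc n)) (fib n) ⟩
  fib (suc (suc m)) * fib (suc n) + fib (suc m) * fib n   ∎
  where
  open ≡-Reasoning
  shuffle : ∀ a b c d → a * (c + d) + b * c ≡ (a + b) * c + a * d
  shuffle = solve-∀

fib-double : ∀ n → fib (2 * n) ≡ fib n * lucas n
fib-double zero    = refl
fib-double (suc m) = begin
  fib (2 * suc m)                                         ≡⟨ cong fib (double-suc m) ⟩
  fib (suc (m + suc m))                                   ≡⟨ fib-+ m (suc m) ⟩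
  fib (suc m) * fib (suc (suc m)) + fib m * fib (suc m)   ≡⟨ factor (fib (suc m)) (fib m) (fib (suc (suc m))) ⟩
  fib (suc m) * lucas (suc m)                             ∎
  where
  open ≡-Reasoning
  double-suc : ∀ m → 2 * suc m ≡ suc (m + suc m)
  double-suc = solve-∀
  factor : ∀ a b c → a * c + b * a ≡ a * (b + c)
  factor = solve-∀

fib-suc-pos : ∀ j → 0 < fib (suc j)
fib-suc-pos zero    = z<s
fib-suc-pos (suc j) = <-≤-trans (fib-suc-pos j) (m≤m+n (fib (suc j)) (fib j))

lucas-suc-pos : ∀ j → 0 < lucas (suc j)
lucas-suc-pos j = <-≤-trans (fib-suc-pos (suc j)) (m≤n+m (fib (2 + j)) (fib j))

ΔY : ℚ × ℚ → ℚ → ℚ × ℚ × ℚ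
ΔY (A , B) C = (A ℚ.* B) /ₜ Σ , (A ℚ.* C) /ₜ Σ , (B ℚ.* C) /ₜ Σ
  where
  Σ : ℚ
  Σ = A ℚ.+ B ℚ.+ C

nextSides : ℚ × ℚ × ℚ → ℚ × ℚ
nextSides (t , s , b) = b , s ℚ.+ 1ℚ

-- (R_A, R_B) of the triangle met at step j + 1; its third side R_C is always 1.
triangleSides : ℕ → ℚ × ℚ
triangleSides zero    = 1ℚ , 1ℚ
triangleSides (suc j) = nextSides (ΔY (triangleSides j) 1ℚ)

closedSides : ℕ → ℚ × ℚ
closedSides j = frac (fib (1 + j)) (lucas (1 + j)) ,
                frac (fib (2 + j) * fib (2 + j)) (fib (1 + j) * lucas (1 + j))

module ClosedForm (j : ℕ) where

  F₁ F₂ L₁ L₂ : ℕ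
  F₁ = fib (1 + j)
  F₂ = fib (2 + j)
  L₁ = lucas (1 + j)
  L₂ = lucas (2 + j)

  private instance
    F₁≢0 : NonZero F₁
    F₁≢0 = >-nonZero (fib-suc-pos j)
    F₂≢0 : NonZero F₂
    F₂≢0 = >-nonZero (fib-suc-pos (suc j))
    L₁≢0 : NonZero L₁
    L₁≢0 = >-nonZero (lucas-suc-pos j)
    L₂≢0 : NonZero L₂
    L₂≢0 = >-nonZero (lucas-suc-pos (suc j))
    F₁L₁≢0 : NonZero (F₁ * L₁)
    F₁L₁≢0 = m*n≢0 F₁ L₁
    F₂L₂≢0 : NonZero (F₂ * L₂)
    F₂L₂≢0 = m*n≢0 F₂ L₂

  A B Σ : ℚ
  A = frac F₁ L₁
  B = frac (F₂ * F₂) (F₁ * L₁)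
  Σ = A ℚ.+ B ℚ.+ 1ℚ

  Σ-numerator : F₁ * F₁ + F₂ * F₂ + F₁ * L₁ ≡ F₂ * L₂
  Σ-numerator = identity (fib j) (fib (suc j))
    where
    identity : ∀ x y → y * y + (y + x) * (y + x) + y * (x + (y + x)) ≡ (y + x) * (y + ((y + x) + y))
    identity = solve-∀

  Σ-closed : Σ ≡ frac (F₂ * L₂) (F₁ * L₁)
  Σ-closed = begin
    A ℚ.+ B ℚ.+ 1ℚ
      ≡⟨ cong₂ (λ p q → p ℚ.+ B ℚ.+ q) (frac-cancelˡ F₁ F₁ L₁) (frac-self {F₁ * L₁}) ⟨
    frac (F₁ * F₁) (F₁ * L₁) ℚ.+ B ℚ.+ frac (F₁ * L₁) (F₁ * L₁)
      ≡⟨ cong (ℚ._+ frac (F₁ * L₁) (F₁ * L₁)) (frac-+ {F₁ * L₁} (F₁ * F₁) (F₂ * F₂)) ⟩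
    frac (F₁ * F₁ + F₂ * F₂) (F₁ * L₁) ℚ.+ frac (F₁ * L₁) (F₁ * L₁)
      ≡⟨ frac-+ {F₁ * L₁} (F₁ * F₁ + F₂ * F₂) (F₁ * L₁) ⟩
    frac (F₁ * F₁ + F₂ * F₂ + F₁ * L₁) (F₁ * L₁)
      ≡⟨ cong (λ n → frac n (F₁ * L₁)) Σ-numerator ⟩
    frac (F₂ * L₂) (F₁ * L₁) ∎
    where open ≡-Reasoning

  B/Σ-closed : B /ₜ frac (F₂ * L₂) (F₁ * L₁) ≡ frac F₂ L₂
  B/Σ-closed = trans (frac-/ₜ (F₂ * F₂) (F₂ * L₂) (F₁ * L₁)) (frac-cancelˡ F₂ F₂ L₂)

  t-closed : (A ℚ.* B) /ₜ Σ ≡ frac (F₁ * F₂) (L₁ * L₂)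
  t-closed = begin
    (A ℚ.* B) /ₜ Σ                          ≡⟨ cong ((A ℚ.* B) /ₜ_) Σ-closed ⟩
    (A ℚ.* B) /ₜ frac (F₂ * L₂) (F₁ * L₁)   ≡⟨ *-/ₜ-assoc A B _ (frac-≢0 {F₁ * L₁} (F₂ * L₂)) ⟩
    A ℚ.* (B /ₜ frac (F₂ * L₂) (F₁ * L₁))   ≡⟨ cong (A ℚ.*_) B/Σ-closed ⟩
    frac F₁ L₁ ℚ.* frac F₂ L₂               ≡⟨ frac-* F₁ L₁ F₂ L₂ ⟩
    frac (F₁ * F₂) (L₁ * L₂)                ∎
    where open ≡-Reasoning

  s-closed : (A ℚ.* 1ℚ) /ₜ Σ ≡ frac (F₁ * F₁) (F₂ * L₂)
  s-closed = begin
    (A ℚ.* 1ℚ) /ₜ Σ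
      ≡⟨ cong₂ _/ₜ_ (trans (*-identityʳ A) (sym (frac-cancelˡ F₁ F₁ L₁))) Σ-closed ⟩
    frac (F₁ * F₁) (F₁ * L₁) /ₜ frac (F₂ * L₂) (F₁ * L₁)
      ≡⟨ frac-/ₜ (F₁ * F₁) (F₂ * L₂) (F₁ * L₁) ⟩
    frac (F₁ * F₁) (F₂ * L₂) ∎
    where open ≡-Reasoning

  b-closed : (B ℚ.* 1ℚ) /ₜ Σ ≡ frac F₂ L₂
  b-closed = trans (cong₂ _/ₜ_ (*-identityʳ B) Σ-closed) B/Σ-closed

  ΔY-closedSides : ΔY (closedSides j) 1ℚ ≡ (frac (F₁ * F₂) (L₁ * L₂) , frac (F₁ * F₁) (F₂ * L₂) , frac F₂ L₂)
  ΔY-closedSides = cong₂ _,_ t-closed (cong₂ _,_ s-closed b-closed)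

  series-numerator : F₁ * F₁ + F₂ * L₂ ≡ fib (3 + j) * fib (3 + j)
  series-numerator = identity (fib j) (fib (suc j))
    where
    identity : ∀ x y → y * y + (y + x) * (y + ((y + x) + y)) ≡ ((y + x) + y) * ((y + x) + y)
    identity = solve-∀

  nextSides-closedSides : nextSides (ΔY (closedSides j) 1ℚ) ≡ closedSides (suc j)
  nextSides-closedSides = cong₂ _,_ b-closed (begin
    (A ℚ.* 1ℚ) /ₜ Σ ℚ.+ 1ℚ
      ≡⟨ cong₂ ℚ._+_ s-closed (sym (frac-self {F₂ * L₂})) ⟩
    frac (F₁ * F₁) (F₂ * L₂) ℚ.+ frac (F₂ * L₂) (F₂ * L₂)
      ≡⟨ frac-+ {F₂ * L₂} (F₁ * F₁) (F₂ * L₂) ⟩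
    frac (F₁ * F₁ + F₂ * L₂) (F₂ * L₂)
      ≡⟨ cong (λ n → frac n (F₂ * L₂)) series-numerator ⟩
    frac (fib (3 + j) * fib (3 + j)) (F₂ * L₂) ∎)
    where open ≡-Reasoning

triangleSides-closed : ∀ j → triangleSides j ≡ closedSides j
triangleSides-closed zero    = refl
triangleSides-closed (suc j) =
  trans (cong (λ l → nextSides (ΔY l 1ℚ)) (triangleSides-closed j)) nextSides-closedSides
  where open ClosedForm j

≡ᵇ-true : ∀ {m n} → m ≡ n → (m ≡ᵇ n) ≡ true
≡ᵇ-true {m} {n} m≡n = to T-≡ (≡⇒≡ᵇ m n m≡n)

≡ᵇ-false : ∀ {m n} → m ≢ n → (m ≡ᵇ n) ≡ false
≡ᵇ-false {m} {n} m≢n with m ≡ᵇ n in eq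
... | false = refl
... | true  = ⊥-elim (m≢n (≡ᵇ⇒≡ m n (from T-≡ eq)))

T-not : ∀ {b} → ¬ T b → T (not b)
T-not {false} _  = _
T-not {true}  ¬b = ¬b _

joins-sound : ∀ u v x y r → T (joins u v (x , y , r)) → (x ≡ u × y ≡ v) ⊎ (x ≡ v × y ≡ u)
joins-sound u v x y _ =
  Sum.map (Product.map (≡ᵇ⇒≡ x u) (≡ᵇ⇒≡ y v) ∘ to T-∧)
          (Product.map (≡ᵇ⇒≡ x v) (≡ᵇ⇒≡ y u) ∘ to T-∧) ∘ to T-∨

Avoids : ℕ → Edge → Set
Avoids a (x , y , _) = x ≢ a × y ≢ a

joins⇒avoids : ∀ {u v a} e → u ≢ a → v ≢ a → T (joins u v e) → Avoids a e
joins⇒avoids {u} {v} (x , y , r) u≢a v≢a j with joins-sound u v x y r j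
... | inj₁ (refl , refl) = u≢a , v≢a
... | inj₂ (refl , refl) = v≢a , u≢a

avoids⇒¬joinsˡ : ∀ {a b} e → Avoids a e → ¬ T (joins a b e)
avoids⇒¬joinsˡ {a} {b} (x , y , r) (x≢a , y≢a) j with joins-sound a b x y r j
... | inj₁ (x≡a , _) = x≢a x≡a
... | inj₂ (_ , y≡a) = y≢a y≡a

avoids⇒¬joinsʳ : ∀ {a b} e → Avoids b e → ¬ T (joins a b e)
avoids⇒¬joinsʳ {a} {b} (x , y , r) (x≢b , y≢b) j with joins-sound a b x y r j
... | inj₁ (_ , y≡b) = y≢b y≡b
... | inj₂ (x≡b , _) = x≢b x≡b

∉⇒¬joins : ∀ {u v x y r} → x ≢ u → x ≢ v → ¬ T (joins u v (x , y , r))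
∉⇒¬joins {u} {v} {x} {y} {r} x≢u x≢v j with joins-sound u v x y r j
... | inj₁ (x≡u , _) = x≢u x≡u
... | inj₂ (x≡v , _) = x≢v x≡v

avoids⇒¬incident : ∀ {a} e → Avoids a e → ¬ T (incident a e)
avoids⇒¬incident (x , y , _) (x≢a , y≢a) i with to T-∨ i
... | inj₁ x≡a = x≢a (≡ᵇ⇒≡ x _ x≡a)
... | inj₂ y≡a = y≢a (≡ᵇ⇒≡ y _ y≡a)

¬incident⇒avoids : ∀ {a} e → T (not (incident a e)) → Avoids a e
¬incident⇒avoids {a} (x , y , _) h with x ≡ᵇ a in p | y ≡ᵇ a in q
... | false | false = (λ x≡a → false≢true (trans (sym p) (≡ᵇ-true x≡a)))
                    , (λ y≡a → false≢true (trans (sym q) (≡ᵇ-true y≡a)))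
  where
  false≢true : false ≢ true
  false≢true ()

res-head : ∀ u v r N → res ((u , v , r) ∷ N) u v ≡ r
res-head u v r N rewrite ≡ᵇ-true {u} refl | ≡ᵇ-true {v} refl = refl

res-skip : ∀ {u v} e N → ¬ T (joins u v e) → res (e ∷ N) u v ≡ res N u v
res-skip {u} {v} (x , y , r) N ¬j with joins u v (x , y , r)
... | false = refl
... | true  = ⊥-elim (¬j _)

res-skip-∉ : ∀ x y r N u v → x ≢ u → x ≢ v → res ((x , y , r) ∷ N) u v ≡ res N u v
res-skip-∉ x y r N u v x≢u x≢v = res-skip (x , y , r) N (∉⇒¬joins {u} {v} {x} {y} {r} x≢u x≢v)

res-skip-avoids : ∀ e N u v → Avoids v e → res (e ∷ N) u v ≡ res N u v
res-skip-avoids e N u v avoid = res-skip e N (avoids⇒¬joinsʳ e avoid)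

res-filterᵇ : ∀ p N {u v} → (∀ e → T (joins u v e) → T (p e)) → res (filterᵇ p N) u v ≡ res N u v
res-filterᵇ p []                      keep = refl
res-filterᵇ p (e@(_ , _ , r) ∷ N) {u} {v} keep with T? (p e)
... | yes pe = trans (cong (λ M → res M u v) (filter-accept (T? ∘ p) pe))
                     (cong (if joins u v e then r else_) (res-filterᵇ p N keep))
... | no ¬pe = trans (cong (λ M → res M u v) (filter-reject (T? ∘ p) ¬pe))
                     (trans (res-filterᵇ p N keep) (sym (res-skip e N (¬pe ∘ keep e))))

res-removeEdge : ∀ a b N {u v} → a ≢ u → a ≢ v → res (removeEdge a b N) u v ≡ res N u v
res-removeEdge a b N a≢u a≢v = res-filterᵇ _ N λ e j →
  T-not (avoids⇒¬joinsˡ e (joins⇒avoids e (≢-sym a≢u) (≢-sym a≢v) j))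

res-deleteVertex : ∀ a N {u v} → a ≢ u → a ≢ v → res (deleteVertex a N) u v ≡ res N u v
res-deleteVertex a N a≢u a≢v = res-filterᵇ _ N λ e j →
  T-not (avoids⇒¬incident e (joins⇒avoids e (≢-sym a≢u) (≢-sym a≢v) j))

renamedFrom : ℕ → ℕ → ℕ → ℕ
renamedFrom a c w = if w ≡ᵇ c then a else w

renamedFrom-target : ∀ a c → renamedFrom a c c ≡ a
renamedFrom-target a c rewrite ≡ᵇ-true {c} refl = refl

renamedFrom-other : ∀ a {c w} → w ≢ c → renamedFrom a c w ≡ w
renamedFrom-other a w≢c rewrite ≡ᵇ-false w≢c = refl

≡ᵇ-rename : ∀ {a c x u} → x ≢ c → u ≢ a → ((if x ≡ᵇ a then c else x) ≡ᵇ u) ≡ (x ≡ᵇ renamedFrom a c u)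
≡ᵇ-rename {a} {c} {x} {u} x≢c u≢a with x ≟ a | u ≟ c
... | yes x≡a | yes u≡c rewrite ≡ᵇ-true x≡a | ≡ᵇ-true u≡c =
  trans (≡ᵇ-true (sym u≡c)) (sym (≡ᵇ-true x≡a))
... | yes x≡a | no u≢c  rewrite ≡ᵇ-true x≡a | ≡ᵇ-false u≢c =
  trans (≡ᵇ-false (u≢c ∘ sym)) (sym (≡ᵇ-false λ x≡u → u≢a (trans (sym x≡u) x≡a)))
... | no x≢a  | yes u≡c rewrite ≡ᵇ-false x≢a | ≡ᵇ-true u≡c =
  trans (≡ᵇ-false λ x≡u → x≢c (trans x≡u u≡c)) (sym (≡ᵇ-false x≢a))
... | no x≢a  | no u≢c  rewrite ≡ᵇ-false x≢a | ≡ᵇ-false u≢c = refl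

res-rename : ∀ a c N {u v} → All (Avoids c) N → u ≢ a → v ≢ a →
  res (rename a c N) u v ≡ res N (renamedFrom a c u) (renamedFrom a c v)
res-rename a c []                 []                    u≢a v≢a = refl
res-rename a c ((x , y , r) ∷ N) {u} {v} ((x≢c , y≢c) ∷ avoid) u≢a v≢a =
  trans (cong (λ j → if j then r else _) joins-renamed)
        (cong (if _ then r else_) (res-rename a c N avoid u≢a v≢a))
  where
  joins-renamed : joins u v ((if x ≡ᵇ a then c else x) , (if y ≡ᵇ a then c else y) , r)
                ≡ joins (renamedFrom a c u) (renamedFrom a c v) (x , y , r)
  joins-renamed = cong₂ _∨_ (cong₂ _∧_ (≡ᵇ-rename x≢c u≢a) (≡ᵇ-rename y≢c v≢a))
                            (cong₂ _∧_ (≡ᵇ-rename x≢c v≢a) (≡ᵇ-rename y≢c u≢a))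

res-edgesFrom-suc : ∀ i m {u v} → i ≢ u → i ≢ v →
  res (edgesFrom i (suc m)) u v ≡ res (edgesFrom (suc i) m) u v
res-edgesFrom-suc i zero                  i≢u i≢v = refl
res-edgesFrom-suc i (suc zero)    {u} {v} i≢u i≢v =
  res-skip-∉ i (suc i) 1ℚ (edgesFrom (suc i) 1) u v i≢u i≢v
res-edgesFrom-suc i (suc (suc m)) {u} {v} i≢u i≢v =
  trans (res-skip-∉ i (suc i) 1ℚ ((i , 2 + i , 1ℚ) ∷ edgesFrom (suc i) (2 + m)) u v i≢u i≢v)
        (res-skip-∉ i (2 + i) 1ℚ (edgesFrom (suc i) (2 + m)) u v i≢u i≢v)

res-edgesFrom-adjacent : ∀ i d m → res (edgesFrom i (2 + (d + m))) (i + d) (suc (i + d)) ≡ 1ℚ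
res-edgesFrom-adjacent i zero zero    rewrite +-identityʳ i = res-head i (suc i) 1ℚ (edgesFrom (suc i) 1)
res-edgesFrom-adjacent i zero (suc m) rewrite +-identityʳ i =
  res-head i (suc i) 1ℚ ((i , 2 + i , 1ℚ) ∷ edgesFrom (suc i) (2 + m))
res-edgesFrom-adjacent i (suc d) m    rewrite +-suc i d =
  trans (res-edgesFrom-suc i (2 + (d + m)) (<⇒≢ i<1+i+d) (<⇒≢ (m<n⇒m<1+n i<1+i+d)))
        (res-edgesFrom-adjacent (suc i) d m)
  where
  i<1+i+d : i < suc (i + d)
  i<1+i+d = s≤s (m≤m+n i d)

res-G-adjacent : ∀ {n} j → 3 + j ≤ n → res (G n) (2 + j) (3 + j) ≡ 1ℚ
res-G-adjacent j h with m≤n⇒∃[o]m+o≡n h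
... | m , refl = res-edgesFrom-adjacent 1 (suc j) m

triangleRemoved : ℕ → Network → Network
triangleRemoved k N = removeEdge k (suc k) (removeEdge k (2 + k) (removeEdge (suc k) (2 + k) N))

withY : ℕ → Network → Network
withY k N = (star , k , t) ∷ (star , suc k , s) ∷ (star , 2 + k , b) ∷ triangleRemoved k N
  where open StepResult (step k N)

-- StepResult.net (step k N) is definitionally rename star (suc k) (seriesReduced k N).
seriesReduced : ℕ → Network → Network
seriesReduced k N = (star , 3 + k , StepResult.s (step k N) ℚ.+ 1ℚ) ∷ deleteVertex (suc k) (withY k N)

seriesReduced-avoids : ∀ k N → All (Avoids (suc k)) (seriesReduced k N)
seriesReduced-avoids k N =
  ((λ ()) , >⇒≢ (m<n⇒m<1+n (n<1+n (suc k))))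
  ∷ All.map (λ {e} → ¬incident⇒avoids e) (all-filter (λ e → T? (not (incident (suc k) e))) (withY k N))

module _ (k : ℕ) (N : Network) where
  open StepResult (step k N)

  private
    SR tail₁ tail₂ : Network
    SR    = seriesReduced k N
    tail₁ = (star , suc k , s) ∷ tail₂
    tail₂ = (star , 2 + k , b) ∷ triangleRemoved k N

  res-step-b : res net (suc k) (2 + k) ≡ b
  res-step-b = begin
    res (rename star (suc k) SR) (suc k) (2 + k)
      ≡⟨ res-rename star (suc k) SR (seriesReduced-avoids k N) (λ ()) (λ ()) ⟩
    res SR (renamedFrom star (suc k) (suc k)) (renamedFrom star (suc k) (2 + k))
      ≡⟨ cong₂ (res SR) (renamedFrom-target star (suc k)) (renamedFrom-other star (>⇒≢ (n<1+n (suc k)))) ⟩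
    res SR star (2 + k)
      ≡⟨ res-skip-avoids (star , 3 + k , s ℚ.+ 1ℚ) (deleteVertex (suc k) (withY k N)) star (2 + k)
           ((λ ()) , >⇒≢ (n<1+n (2 + k))) ⟩
    res (deleteVertex (suc k) (withY k N)) star (2 + k)
      ≡⟨ res-deleteVertex (suc k) (withY k N) (λ ()) (<⇒≢ (n<1+n (suc k))) ⟩
    res (withY k N) star (2 + k)
      ≡⟨ res-skip-avoids (star , k , t) tail₁ star (2 + k) ((λ ()) , <⇒≢ (m<n⇒m<1+n (n<1+n k))) ⟩
    res tail₁ star (2 + k)
      ≡⟨ res-skip-avoids (star , suc k , s) tail₂ star (2 + k) ((λ ()) , <⇒≢ (n<1+n (suc k))) ⟩
    res tail₂ star (2 + k)
      ≡⟨ res-head star (2 + k) b (triangleRemoved k N) ⟩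
    b ∎
    where open ≡-Reasoning

  res-step-s : res net (suc k) (3 + k) ≡ s ℚ.+ 1ℚ
  res-step-s = begin
    res (rename star (suc k) SR) (suc k) (3 + k)
      ≡⟨ res-rename star (suc k) SR (seriesReduced-avoids k N) (λ ()) (λ ()) ⟩
    res SR (renamedFrom star (suc k) (suc k)) (renamedFrom star (suc k) (3 + k))
      ≡⟨ cong₂ (res SR) (renamedFrom-target star (suc k))
                        (renamedFrom-other star (>⇒≢ (m<n⇒m<1+n (n<1+n (suc k))))) ⟩
    res SR star (3 + k)
      ≡⟨ res-head star (3 + k) (s ℚ.+ 1ℚ) (deleteVertex (suc k) (withY k N)) ⟩
    s ℚ.+ 1ℚ ∎
    where open ≡-Reasoning

  res-step-far : ∀ {u v} → 2 + k ≤ u → 2 + k ≤ v → res net u v ≡ res N u v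
  res-step-far {u} {v} hu hv = begin
    res (rename star (suc k) SR) u v
      ≡⟨ res-rename star (suc k) SR (seriesReduced-avoids k N) (≢-sym (star≢ hu)) (≢-sym (star≢ hv)) ⟩
    res SR (renamedFrom star (suc k) u) (renamedFrom star (suc k) v)
      ≡⟨ cong₂ (res SR) (renamedFrom-other star (≢-sym (<⇒≢ hu))) (renamedFrom-other star (≢-sym (<⇒≢ hv))) ⟩
    res SR u v
      ≡⟨ res-skip-∉ star (3 + k) (s ℚ.+ 1ℚ) (deleteVertex (suc k) (withY k N)) u v (star≢ hu) (star≢ hv) ⟩
    res (deleteVertex (suc k) (withY k N)) u v
      ≡⟨ res-deleteVertex (suc k) (withY k N) (<⇒≢ hu) (<⇒≢ hv) ⟩
    res (withY k N) u v
      ≡⟨ trans (res-skip-∉ star k t tail₁ u v (star≢ hu) (star≢ hv))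
               (trans (res-skip-∉ star (suc k) s tail₂ u v (star≢ hu) (star≢ hv))
                      (res-skip-∉ star (2 + k) b (triangleRemoved k N) u v (star≢ hu) (star≢ hv))) ⟩
    res (triangleRemoved k N) u v
      ≡⟨ trans (res-removeEdge k (suc k) (removeEdge k (2 + k) (removeEdge (suc k) (2 + k) N)) (k≢ hu) (k≢ hv))
               (trans (res-removeEdge k (2 + k) (removeEdge (suc k) (2 + k) N) (k≢ hu) (k≢ hv))
                      (res-removeEdge (suc k) (2 + k) N (<⇒≢ hu) (<⇒≢ hv))) ⟩
    res N u v ∎
    where
    open ≡-Reasoning
    star≢ : ∀ {w} → 2 + k ≤ w → star ≢ w
    star≢ h = <⇒≢ (≤-trans (s≤s z≤n) h)
    k≢ : ∀ {w} → 2 + k ≤ w → k ≢ w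
    k≢ h = <⇒≢ (≤-trans (n≤1+n (suc k)) h)

res-steps-far : ∀ j N {u v} → 2 + j ≤ u → 2 + j ≤ v → res (steps j N) u v ≡ res N u v
res-steps-far zero    N hu hv = refl
res-steps-far (suc j) N hu hv =
  trans (res-step-far (suc j) (steps j N) hu hv) (res-steps-far j N (<⇒≤ hu) (<⇒≤ hv))

res-steps-RC : ∀ {n} j → 3 + j ≤ n → res (steps j (G n)) (2 + j) (3 + j) ≡ 1ℚ
res-steps-RC {n} j h = trans (res-steps-far j (G n) ≤-refl (n≤1+n _)) (res-G-adjacent j h)

res-steps-sides : ∀ {n} j → 3 + j ≤ n →
  (res (steps j (G n)) (1 + j) (2 + j) , res (steps j (G n)) (1 + j) (3 + j)) ≡ triangleSides j
res-steps-sides zero (s≤s (s≤s (s≤s _))) = refl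
res-steps-sides {n} (suc j) h = trans
  (cong₂ _,_ (res-step-b (suc j) (steps j (G n))) (res-step-s (suc j) (steps j (G n))))
  (cong nextSides (cong₂ ΔY (res-steps-sides j (<⇒≤ h)) (res-steps-RC j (<⇒≤ h))))

fib-2p+2 : ∀ j → fib (2 * suc j + 2) ≡ fib (2 + j) * lucas (2 + j)
fib-2p+2 j = trans (cong fib (arith j)) (fib-double (2 + j))
  where
  arith : ∀ j → 2 * suc j + 2 ≡ 2 * (2 + j)
  arith = solve-∀

lemma3p3 : (n : ℕ) → 4 ≤ n → (p : ℕ) → 1 ≤ p → p ≤ (n ∸ 2) ∸ 1 →
    (sₚ n p ≡ ι (fib p * fib p) /ₜ ι (fib (2 * p + 2)))
    × (bₚ n p ≡ ι (fib (p + 1)) /ₜ ι (lucas (p + 1)))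
    × (tₚ n p ≡ ι (fib p * fib (p + 1)) /ₜ ι (lucas p * lucas (p + 1)))
lemma3p3 n (s≤s (s≤s (s≤s (s≤s _)))) (suc j) _ p≤n∸3
  rewrite +-comm j 1 | fib-2p+2 j = cong (proj₁ ∘ proj₂) tsb , cong (proj₂ ∘ proj₂) tsb , cong proj₁ tsb
  where
  h : 3 + j ≤ n
  h = s≤s (s≤s (s≤s (<⇒≤ p≤n∸3)))
  open ClosedForm j
  tsb : (tₚ n (suc j) , sₚ n (suc j) , bₚ n (suc j))
      ≡ (frac (F₁ * F₂) (L₁ * L₂) , frac (F₁ * F₁) (F₂ * L₂) , frac F₂ L₂)
  tsb = trans (cong₂ ΔY (trans (res-steps-sides j h) (triangleSides-closed j)) (res-steps-RC j h)) ΔY-closedSides
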